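{- Let $R$ be a finite ring (associative, with nonzero identity) with Jacobson radical $J(R)$, and let $\bar{\mathcal{M}}$ be a maximal independent set of $\Gamma'(R/J(R))$; for $r\in R$ write $\bar r$ for its image in $R/J(R)$. (1) If $\bar{\mathcal{M}}\subseteq (R/J(R))\setminus U(R/J(R))$ and $\mathcal{M}\subseteq R$ is a subset whose image in $R/J(R)$ is $\bar{\mathcal{M}}$, then $\mathcal{M}+J(R)$ is a maximal independent set of $\Gamma'(R)$ of size $|\bar{\mathcal{M}}|\,|J(R)|$. (2) If $\bar{\mathcal{M}}\subseteq U(R/J(R))$ and $2\in U(R)$, and $\mathcal{M}\subseteq R$ is a complete set of representatives of $\bar{\mathcal{M}}$ (i.e. $r\mapsto\bar r$ is a bijection from $\mathcal{M}$ onto $\bar{\mathcal{M}}$), then $\mathcal{M}$ is a maximal independent set of $\Gamma'(R)$ with $|\mathcal{M}|=|\bar{\mathcal{M}}|$.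
   Context: $U(S)$ is the set of units of a ring $S$. The unit graph $\Gamma'(S)$ has vertex set $S$, two distinct vertices $x,y$ adjacent iff $x+y\in U(S)$. -}

module Defs where

open import Level using (0ℓ)
open import Data.Nat using (ℕ)
open import Data.Fin using (Fin)
open import Data.Fin.Subset using (Subset; _∈_; _∉_; _⊆_)
open import Data.Product using (Σ; ∃; _×_; _,_)
open import Data.Sum using (_⊎_)
open import Relation.Nullary using (¬_)
open import Relation.Binary.PropositionalEquality using (_≡_; _≢_)
open import Algebra.Structures using (IsRing)
open import Function.Bundles using (_⇔_)

-- A finite ring (associative, with identity), presented (up to isomorphism)
-- with carrier Fin size and propositional equality.
record FiniteRing : Set where
  infixl 6 _+_
  infixl 7 _*_
  field
    size   : ℕ
    _+_    : Fin size → Fin size → Fin size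
    _*_    : Fin size → Fin size → Fin size
    -_     : Fin size → Fin size
    0#     : Fin size
    1#     : Fin size
    isRing : IsRing _≡_ _+_ _*_ -_ 0# 1#
    1≢0    : 1# ≢ 0#

module _ (R : FiniteRing) where
  open FiniteRing R

  Elt : Set
  Elt = Fin size

  IsUnit : Elt → Set
  IsUnit x = Σ Elt λ y → (x * y ≡ 1#) × (y * x ≡ 1#)

  Adjacent : Elt → Elt → Set
  Adjacent x y = (x ≢ y) × IsUnit (x + y)

  IndependentSet : Subset size → Set
  IndependentSet A = ∀ x y → x ∈ A → y ∈ A → ¬ Adjacent x y

  MaximalIndependentSet : Subset size → Set
  MaximalIndependentSet A =
    IndependentSet A × (∀ B → IndependentSet B → A ⊆ B → B ⊆ A)

  IsLeftIdeal : Subset size → Set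
  IsLeftIdeal I = (0# ∈ I)
    × (∀ x y → x ∈ I → y ∈ I → (x + y) ∈ I)
    × (∀ r x → x ∈ I → (r * x) ∈ I)

  IsMaximalLeftIdeal : Subset size → Set
  IsMaximalLeftIdeal I = IsLeftIdeal I × (1# ∉ I)
    × (∀ K → IsLeftIdeal K → I ⊆ K → (K ⊆ I) ⊎ (1# ∈ K))

  InJacobson : Elt → Set
  InJacobson x = ∀ I → IsMaximalLeftIdeal I → x ∈ I

record IsRingHom (R S : FiniteRing) (f : Fin (FiniteRing.size R) → Fin (FiniteRing.size S)) : Set where
  private
    module R = FiniteRing R
    module S = FiniteRing S
  field
    +-hom : ∀ x y → f (x R.+ y) ≡ f x S.+ f y
    *-hom : ∀ x y → f (x R.* y) ≡ f x S.* f y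
    1-hom : f R.1# ≡ S.1#

record IsQuotientByJacobson (R S : FiniteRing) (π : Fin (FiniteRing.size R) → Fin (FiniteRing.size S)) : Set where
  field
    hom        : IsRingHom R S π
    surjective : ∀ y → ∃ λ x → π x ≡ y
    kernel     : ∀ x → (π x ≡ FiniteRing.0# S) ⇔ InJacobson R x

{-# OPTIONS --safe #-}
module Submission where

-- The key fact is that units lift along π : R → R/J(R). If π u is a unit with inverse π v, then
-- 1 - vu ∈ J(R), so the left ideal R(vu) lies in no maximal left ideal and vu has a left inverse;
-- thus u has a left inverse l, which is again a unit modulo J(R), hence has a left inverse of its
-- own, and this forces l to be a two-sided inverse of u. Consequently π preserves and reflects
-- adjacency between elements with different images, so an independent set B of Γ'(R) whose image
-- covers M̄ maps into M̄ (any other image point could be added to M̄).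
-- (1) An edge x, y inside a fibre makes π x + π x, hence π x, a unit; so the preimage of a set of
-- non-units is independent as soon as the set is, and the preimage of M̄, which is M + J(R), is
-- maximal. Every fibre is a coset of J(R), whence its size.
-- (2) If 2 is a unit, two distinct elements b, m of a fibre over a unit are adjacent, because
-- b + m ≡ 2m modulo J(R) and 2m is a unit; so an independent set containing M contains nothing
-- else.

open import Defs
open import Level using (Level; 0ℓ)
open import Function using (_∘_)
open import Function.Bundles using (_⇔_; module Equivalence)
open import Data.Empty using (⊥-elim)
open import Data.Sum using (_⊎_; inj₁; inj₂)
open import Data.Product using (∃; _×_; _,_; proj₁; proj₂; map; map₁; map₂)
open import Data.Nat using (ℕ; zero; suc; _≤_; s≤s; z≤n)
open import Data.Nat.Properties using (+-suc; ≤-trans; ≤-antisym)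
open import Data.Nat.Induction using (<-wellFounded)
open import Data.Fin using (Fin; zero; suc)
open import Data.Fin.Properties using (_≟_; any?; all?; 0≢1+n; suc-injective; ¬Fin0)
open import Data.Fin.Subset
  using (Subset; _∈_; _∉_; _⊆_; _⊂_; _⊃_; _∩_; _∪_; ∁; ⁅_⁆; _-_; ∣_∣; Empty; inside; outside)
open import Data.Fin.Subset.Properties
open import Data.Vec using ([]; _∷_; here; there; tabulate)
open import Data.Vec.Properties using (lookup∘tabulate; []=⇒lookup; lookup⇒[]=)
open import Induction.WellFounded using (WellFounded; Acc; acc; module Subrelation)
import Relation.Binary.Construct.On as On
open import Relation.Binary.PropositionalEquality
  using (_≡_; _≢_; refl; sym; trans; cong; cong₂; subst; module ≡-Reasoning)
open import Relation.Nullary using (¬_; yes; no; does)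
open import Relation.Nullary.Decidable
  using (dec-true; decidable-stable; _×-dec_; _→-dec_; ¬?)
open import Relation.Unary using (Pred; Decidable)
open import Algebra.Bundles using (Ring)
import Algebra.Properties.Group as GroupProperties

private
  variable
    ℓ : Level
    n m : ℕ

decSubset : {P : Pred (Fin n) ℓ} → Decidable P → Subset n
decSubset P? = tabulate (does ∘ P?)

module _ {P : Pred (Fin n) ℓ} (P? : Decidable P) {x : Fin n} where

  ∈-decSubset⁺ : P x → x ∈ decSubset P?
  ∈-decSubset⁺ Px = lookup⇒[]= x _ (trans (lookup∘tabulate _ x) (dec-true (P? x) Px))

  ∈-decSubset⁻ : x ∈ decSubset P? → P x
  ∈-decSubset⁻ x∈ with P? x | trans (sym (lookup∘tabulate _ x)) ([]=⇒lookup x∈)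
  ... | yes Px | _ = Px

-- Opaque, so that f and c can be inferred from the type x ∈ preimage f c.
opaque
  preimage : (Fin n → Fin m) → Subset m → Subset n
  preimage f c = decSubset (λ x → f x ∈? c)

  ∈-preimage⁺ : ∀ {f : Fin n → Fin m} {c x} → f x ∈ c → x ∈ preimage f c
  ∈-preimage⁺ {f = f} {c} = ∈-decSubset⁺ (λ y → f y ∈? c)

  ∈-preimage⁻ : ∀ {f : Fin n → Fin m} {c x} → x ∈ preimage f c → f x ∈ c
  ∈-preimage⁻ {f = f} {c} = ∈-decSubset⁻ (λ y → f y ∈? c)

module _ (f : Fin n → Fin m) where

  preimage-∩ : ∀ c d → preimage f (c ∩ d) ≡ preimage f c ∩ preimage f d
  preimage-∩ c d = ⊆-antisym
    (λ x∈ → x∈p∩q⁺ (map ∈-preimage⁺ ∈-preimage⁺ (x∈p∩q⁻ c d (∈-preimage⁻ x∈))))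
    (λ x∈ → ∈-preimage⁺ (x∈p∩q⁺ (map ∈-preimage⁻ ∈-preimage⁻ (x∈p∩q⁻ _ _ x∈))))

  preimage-∁ : ∀ c → preimage f (∁ c) ≡ ∁ (preimage f c)
  preimage-∁ c = ⊆-antisym
    (λ x∈ → x∉p⇒x∈∁p (x∈∁p⇒x∉p (∈-preimage⁻ x∈) ∘ ∈-preimage⁻))
    (λ x∈ → ∈-preimage⁺ (x∉p⇒x∈∁p (x∈∁p⇒x∉p x∈ ∘ ∈-preimage⁺)))

x∈p⇒p∩⁅x⁆≡⁅x⁆ : ∀ {p : Subset n} {x} → x ∈ p → p ∩ ⁅ x ⁆ ≡ ⁅ x ⁆
x∈p⇒p∩⁅x⁆≡⁅x⁆ {p = p} {x} x∈p = ⊆-antisym (p∩q⊆q p ⁅ x ⁆)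
  (λ y∈⁅x⁆ → x∈p∩q⁺ (subst (_∈ p) (sym (x∈⁅y⁆⇒x≡y x y∈⁅x⁆)) x∈p , y∈⁅x⁆))

Empty⇒∣p∣≡0 : {p : Subset n} → Empty p → ∣ p ∣ ≡ 0
Empty⇒∣p∣≡0 {n} empty = trans (cong ∣_∣ (Empty-unique empty)) (∣⊥∣≡0 n)

injectiveOn⇒∣p∣≤∣q∣ : ∀ {p : Subset n} {q : Subset m} (f : Fin n → Fin m) →
  (∀ {x} → x ∈ p → f x ∈ q) →
  (∀ {x y} → x ∈ p → y ∈ p → f x ≡ f y → x ≡ y) →
  ∣ p ∣ ≤ ∣ q ∣
injectiveOn⇒∣p∣≤∣q∣ {p = []} f _ _ = z≤n
injectiveOn⇒∣p∣≤∣q∣ {p = outside ∷ p} f into inj =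
  injectiveOn⇒∣p∣≤∣q∣ (f ∘ suc) (into ∘ there) (λ x∈ y∈ → suc-injective ∘ inj (there x∈) (there y∈))
injectiveOn⇒∣p∣≤∣q∣ {p = inside ∷ p} {q} f into inj = ≤-trans
  (s≤s (injectiveOn⇒∣p∣≤∣q∣ (f ∘ suc) into-q-f₀
    (λ x∈ y∈ → suc-injective ∘ inj (there x∈) (there y∈))))
  (x∈p⇒∣p-x∣<∣p∣ (into here))
  where
  into-q-f₀ : ∀ {x} → x ∈ p → f (suc x) ∈ q - f zero
  into-q-f₀ x∈ = x∈p∧x≢y⇒x∈p-y (into (there x∈)) (0≢1+n ∘ sym ∘ inj (there x∈) here)

surjectiveOn⇒∣q∣≤∣p∣ : ∀ {p : Subset n} {q : Subset m} (f : Fin n → Fin m) →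
  (∀ {y} → y ∈ q → ∃ λ x → x ∈ p × f x ≡ y) →
  ∣ q ∣ ≤ ∣ p ∣
surjectiveOn⇒∣q∣≤∣p∣ {zero} {p = []} f onto =
  subst (_≤ 0) (sym (Empty⇒∣p∣≡0 λ (_ , y∈q) → ¬Fin0 (proj₁ (onto y∈q)))) z≤n
surjectiveOn⇒∣q∣≤∣p∣ {suc n} {m} {p} {q} f onto =
  injectiveOn⇒∣p∣≤∣q∣ section (proj₁ ∘ section-spec) section-injective
  where
  section : Fin m → Fin (suc n)
  section y with y ∈? q
  ... | yes y∈q = proj₁ (onto y∈q)
  ... | no _    = zero

  section-spec : ∀ {y} → y ∈ q → section y ∈ p × f (section y) ≡ y
  section-spec {y} y∈q with y ∈? q
  ... | yes y∈q′ = proj₂ (onto y∈q′)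
  ... | no y∉q   = ⊥-elim (y∉q y∈q)

  section-injective : ∀ {y y′} → y ∈ q → y′ ∈ q → section y ≡ section y′ → y ≡ y′
  section-injective y∈q y′∈q s≡s′ =
    trans (sym (proj₂ (section-spec y∈q))) (trans (cong f s≡s′) (proj₂ (section-spec y′∈q)))

⊂-wellFounded : WellFounded (_⊂_ {n})
⊂-wellFounded = Subrelation.wellFounded p⊂q⇒∣p∣<∣q∣ (On.wellFounded ∣_∣ <-wellFounded)

⊃-wellFounded : WellFounded (_⊃_ {n})
⊃-wellFounded =
  Subrelation.wellFounded (p⊂q⇒∣p∣<∣q∣ ∘ p⊂q⇒∁p⊃∁q) (On.wellFounded (∣_∣ ∘ ∁) <-wellFounded)

-- Local, since the ring modules below use the names _+_ and _*_ for the ring operations.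
module _ where

  open import Data.Nat using (_+_; _*_)

  ∣p∣≡∣p∩q∣+∣p∩∁q∣ : ∀ (p q : Subset n) → ∣ p ∣ ≡ ∣ p ∩ q ∣ + ∣ p ∩ ∁ q ∣
  ∣p∣≡∣p∩q∣+∣p∩∁q∣ []            []            = refl
  ∣p∣≡∣p∩q∣+∣p∩∁q∣ (outside ∷ p) (_ ∷ q)       = ∣p∣≡∣p∩q∣+∣p∩∁q∣ p q
  ∣p∣≡∣p∩q∣+∣p∩∁q∣ (inside  ∷ p) (inside  ∷ q) = cong suc (∣p∣≡∣p∩q∣+∣p∩∁q∣ p q)
  ∣p∣≡∣p∩q∣+∣p∩∁q∣ (inside  ∷ p) (outside ∷ q) =
    trans (cong suc (∣p∣≡∣p∩q∣+∣p∩∁q∣ p q)) (sym (+-suc _ _))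

  x∈p⇒∣p∣≡1+∣p∩∁⁅x⁆∣ : ∀ {p : Subset n} {x} → x ∈ p → ∣ p ∣ ≡ suc ∣ p ∩ ∁ ⁅ x ⁆ ∣
  x∈p⇒∣p∣≡1+∣p∩∁⁅x⁆∣ {p = p} {x} x∈p = trans (∣p∣≡∣p∩q∣+∣p∩∁q∣ p ⁅ x ⁆)
    (cong (_+ ∣ p ∩ ∁ ⁅ x ⁆ ∣) (trans (cong ∣_∣ (x∈p⇒p∩⁅x⁆≡⁅x⁆ x∈p)) (∣⁅x⁆∣≡1 x)))

  ∣preimage∣≡∣preimage∩∣+∣preimage∩∁∣ : ∀ (f : Fin n → Fin m) c d →
    ∣ preimage f c ∣ ≡ ∣ preimage f (c ∩ d) ∣ + ∣ preimage f (c ∩ ∁ d) ∣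
  ∣preimage∣≡∣preimage∩∣+∣preimage∩∁∣ f c d = trans (∣p∣≡∣p∩q∣+∣p∩∁q∣ (preimage f c) (preimage f d))
    (sym (cong₂ (λ p q → ∣ p ∣ + ∣ q ∣) (preimage-∩ f c d)
      (trans (preimage-∩ f c (∁ d)) (cong (preimage f c ∩_) (preimage-∁ f d)))))

  ∣preimage∣≡∣c∣*k : ∀ (f : Fin n → Fin m) k → (∀ y → ∣ preimage f ⁅ y ⁆ ∣ ≡ k) →
    ∀ c → ∣ preimage f c ∣ ≡ ∣ c ∣ * k
  ∣preimage∣≡∣c∣*k f k fibre c = go (⊂-wellFounded c)
    where
    open ≡-Reasoning
    go : ∀ {c} → Acc _⊂_ c → ∣ preimage f c ∣ ≡ ∣ c ∣ * k
    go {c} (acc smaller) with nonempty? c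
    ... | no empty = trans (Empty⇒∣p∣≡0 λ (x , x∈) → empty (f x , ∈-preimage⁻ x∈))
                           (cong (_* k) (sym (Empty⇒∣p∣≡0 empty)))
    ... | yes (y , y∈c) = begin
      ∣ preimage f c ∣
        ≡⟨ ∣preimage∣≡∣preimage∩∣+∣preimage∩∁∣ f c ⁅ y ⁆ ⟩
      ∣ preimage f (c ∩ ⁅ y ⁆) ∣ + ∣ preimage f c′ ∣
        ≡⟨ cong (λ p → ∣ preimage f p ∣ + ∣ preimage f c′ ∣) (x∈p⇒p∩⁅x⁆≡⁅x⁆ y∈c) ⟩
      ∣ preimage f ⁅ y ⁆ ∣ + ∣ preimage f c′ ∣
        ≡⟨ cong₂ _+_ (fibre y) (go (smaller c′⊂c)) ⟩
      k + ∣ c′ ∣ * k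
        ≡⟨ cong (_* k) (sym (x∈p⇒∣p∣≡1+∣p∩∁⁅x⁆∣ y∈c)) ⟩
      ∣ c ∣ * k
        ∎
      where
      c′ : Subset _
      c′ = c ∩ ∁ ⁅ y ⁆
      c′⊂c : c′ ⊂ c
      c′⊂c = p∩q⊆p c _ , y , y∈c , λ y∈c′ → x∈∁p⇒x∉p (proj₂ (x∈p∩q⁻ c _ y∈c′)) (x∈⁅x⁆ y)

extendToMaximal : {P : Pred (Subset n) ℓ} → Decidable P → ∀ {p} → P p →
  ∃ λ q → p ⊆ q × P q × (∀ {r} → P r → q ⊆ r → r ⊆ q)
extendToMaximal {P = P} P? {p} Pp = go (⊃-wellFounded p) Pp
  where
  go : ∀ {p} → Acc _⊃_ p → P p → ∃ λ q → p ⊆ q × P q × (∀ {r} → P r → q ⊆ r → r ⊆ q)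
  go {p} (acc larger) Pp with anySubset? (λ r → P? r ×-dec p ⊂? r)
  ... | yes (r , Pr , p⊂r) =
    let q , r⊆q , Pq , q-max = go (larger p⊂r) Pr in q , ⊆-trans (p⊂q⇒p⊆q p⊂r) r⊆q , Pq , q-max
  ... | no ∄larger = p , ⊆-refl , Pp , λ {r} Pr p⊆r {x} x∈r →
    decidable-stable (x ∈? p) (λ x∉p → ∄larger (r , Pr , p⊆r , x , x∈r , x∉p))

module FiniteRingProperties (R : FiniteRing) where

  open FiniteRing R public
  open ≡-Reasoning

  ring : Ring 0ℓ 0ℓ
  ring = record
    { Carrier = Elt R ; _≈_ = _≡_ ; _+_ = _+_ ; _*_ = _*_ ; -_ = -_ ; 0# = 0# ; 1# = 1#
    ; isRing = isRing
    }

  open Ring ring public using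
    ( +-comm; +-identityʳ; -‿inverseˡ; -‿inverseʳ
    ; *-assoc; *-identityˡ; *-identityʳ; distribˡ; distribʳ; zeroˡ
    )
  open GroupProperties (Ring.+-group ring) public
    using (inverseʳ-unique) renaming (∙-cancelˡ to +-cancelˡ; \\-leftDividesˡ to x+[-x+y]≡y)

  x+x≡[1+1]*x : ∀ x → x + x ≡ (1# + 1#) * x
  x+x≡[1+1]*x x = sym (trans (distribʳ x 1# 1#) (cong₂ _+_ (*-identityˡ x) (*-identityˡ x)))

  IsUnit[x+x]⇒IsUnit[x] : ∀ {x} → IsUnit R (x + x) → IsUnit R x
  IsUnit[x+x]⇒IsUnit[x] {x} (v , [x+x]v≡1 , v[x+x]≡1) = v + v
    , trans (distribˡ x v v) (trans (sym (distribʳ v x x)) [x+x]v≡1)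
    , trans (distribʳ x v v) (trans (sym (distribˡ v x x)) v[x+x]≡1)

  IsUnit-* : ∀ {x y} → IsUnit R x → IsUnit R y → IsUnit R (x * y)
  IsUnit-* (x′ , xx′≡1 , x′x≡1) (y′ , yy′≡1 , y′y≡1) =
    y′ * x′ , [ab][b′a′]≡1 xx′≡1 yy′≡1 , [ab][b′a′]≡1 y′y≡1 x′x≡1
    where
    [ab][b′a′]≡1 : ∀ {a a′ b b′} → a * a′ ≡ 1# → b * b′ ≡ 1# → (a * b) * (b′ * a′) ≡ 1#
    [ab][b′a′]≡1 {a} {a′} {b} {b′} aa′≡1 bb′≡1 = begin
      (a * b) * (b′ * a′)  ≡⟨ *-assoc a b (b′ * a′) ⟩
      a * (b * (b′ * a′))  ≡⟨ cong (a *_) (sym (*-assoc b b′ a′)) ⟩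
      a * ((b * b′) * a′)  ≡⟨ cong (λ t → a * (t * a′)) bb′≡1 ⟩
      a * (1# * a′)        ≡⟨ cong (a *_) (*-identityˡ a′) ⟩
      a * a′               ≡⟨ aa′≡1 ⟩
      1#                   ∎

  leftInverse≡rightInverse : ∀ {l u v} → l * u ≡ 1# → u * v ≡ 1# → l ≡ v
  leftInverse≡rightInverse {l} {u} {v} lu≡1 uv≡1 = begin
    l            ≡⟨ sym (*-identityʳ l) ⟩
    l * 1#       ≡⟨ cong (l *_) (sym uv≡1) ⟩
    l * (u * v)  ≡⟨ sym (*-assoc l u v) ⟩
    (l * u) * v  ≡⟨ cong (_* v) lu≡1 ⟩
    1# * v       ≡⟨ *-identityˡ v ⟩
    v            ∎

  leftInverse-of-unit-isUnit : ∀ {l u} → l * u ≡ 1# → IsUnit R u → IsUnit R l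
  leftInverse-of-unit-isUnit lu≡1 (v , uv≡1 , _) =
    _ , lu≡1 , subst (λ t → _ * t ≡ 1#) (sym (leftInverse≡rightInverse lu≡1 uv≡1)) uv≡1

module UnitGraphProperties (R : FiniteRing) where

  open FiniteRingProperties R

  Adjacent-sym : ∀ {x y} → Adjacent R x y → Adjacent R y x
  Adjacent-sym {x} {y} (x≢y , x+y-unit) = x≢y ∘ sym , subst (IsUnit R) (+-comm x y) x+y-unit

  independent-∪⁅⁆ : ∀ {A y} → IndependentSet R A → (∀ x → x ∈ A → ¬ Adjacent R x y) →
    IndependentSet R (A ∪ ⁅ y ⁆)
  independent-∪⁅⁆ {A} {y} A-ind y-nonAdj x z x∈ z∈ with x∈p∪q⁻ A ⁅ y ⁆ x∈ | x∈p∪q⁻ A ⁅ y ⁆ z∈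
  ... | inj₁ x∈A | inj₁ z∈A = A-ind x z x∈A z∈A
  ... | inj₁ x∈A | inj₂ z∈⁅y⁆ rewrite x∈⁅y⁆⇒x≡y y z∈⁅y⁆ = y-nonAdj x x∈A
  ... | inj₂ x∈⁅y⁆ | inj₁ z∈A rewrite x∈⁅y⁆⇒x≡y y x∈⁅y⁆ = y-nonAdj z z∈A ∘ Adjacent-sym
  ... | inj₂ x∈⁅y⁆ | inj₂ z∈⁅y⁆ = λ (x≢z , _) →
    x≢z (trans (x∈⁅y⁆⇒x≡y y x∈⁅y⁆) (sym (x∈⁅y⁆⇒x≡y y z∈⁅y⁆)))

  nonAdjacent⇒∈ : ∀ {A y} → MaximalIndependentSet R A → (∀ x → x ∈ A → ¬ Adjacent R x y) → y ∈ A
  nonAdjacent⇒∈ {A} {y} (A-ind , A-max) y-nonAdj =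
    A-max (A ∪ ⁅ y ⁆) (independent-∪⁅⁆ A-ind y-nonAdj) (p⊆p∪q ⁅ y ⁆) (q⊆p∪q A ⁅ y ⁆ (x∈⁅x⁆ y))

module LeftIdealProperties (R : FiniteRing) where

  open FiniteRingProperties R

  isLeftIdeal? : Decidable (IsLeftIdeal R)
  isLeftIdeal? I = 0# ∈? I
    ×-dec all? (λ x → all? λ y → x ∈? I →-dec y ∈? I →-dec (x + y) ∈? I)
    ×-dec all? (λ r → all? λ x → x ∈? I →-dec (r * x) ∈? I)

  proper⇒⊆maximal : ∀ {I} → IsLeftIdeal R I → 1# ∉ I → ∃ λ K → I ⊆ K × IsMaximalLeftIdeal R K
  proper⇒⊆maximal I-ideal 1∉I
    with extendToMaximal (λ K → isLeftIdeal? K ×-dec ¬? (1# ∈? K)) (I-ideal , 1∉I)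
  ... | K , I⊆K , (K-ideal , 1∉K) , K-max = K , I⊆K , K-ideal , 1∉K , maximal
    where
    maximal : ∀ K′ → IsLeftIdeal R K′ → K ⊆ K′ → K′ ⊆ K ⊎ 1# ∈ K′
    maximal K′ K′-ideal K⊆K′ with 1# ∈? K′
    ... | yes 1∈K′ = inj₂ 1∈K′
    ... | no 1∉K′ = inj₁ (K-max (K′-ideal , 1∉K′) K⊆K′)

  principal : Elt R → Subset size
  principal a = decSubset (λ x → any? λ r → r * a ≟ x)

  ∈-principal⁺ : ∀ r a → r * a ∈ principal a
  ∈-principal⁺ r a = ∈-decSubset⁺ (λ x → any? λ r → r * a ≟ x) (r , refl)

  ∈-principal⁻ : ∀ {a x} → x ∈ principal a → ∃ λ r → r * a ≡ x
  ∈-principal⁻ {a} = ∈-decSubset⁻ (λ x → any? λ r → r * a ≟ x)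

  principal-isLeftIdeal : ∀ a → IsLeftIdeal R (principal a)
  principal-isLeftIdeal a =
    subst (_∈ principal a) (zeroˡ a) (∈-principal⁺ 0# a) ,
    (λ x y x∈ y∈ → +-closed (∈-principal⁻ x∈) (∈-principal⁻ y∈)) ,
    (λ r x x∈ → *-closed r (∈-principal⁻ x∈))
    where
    +-closed : ∀ {x y} → ∃ (λ r → r * a ≡ x) → ∃ (λ s → s * a ≡ y) → x + y ∈ principal a
    +-closed (r , refl) (s , refl) =
      subst (_∈ principal a) (distribʳ a r s) (∈-principal⁺ (r + s) a)
    *-closed : ∀ r {x} → ∃ (λ s → s * a ≡ x) → r * x ∈ principal a
    *-closed r (s , refl) = subst (_∈ principal a) (*-assoc r s a) (∈-principal⁺ (r * s) a)

  -a+1∈J⇒leftInvertible : ∀ a → InJacobson R (- a + 1#) → ∃ λ w → w * a ≡ 1#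
  -a+1∈J⇒leftInvertible a -a+1∈J with 1# ∈? principal a
  ... | yes 1∈Ra = ∈-principal⁻ 1∈Ra
  ... | no 1∉Ra with proper⇒⊆maximal (principal-isLeftIdeal a) 1∉Ra
  ... | K , Ra⊆K , K-max@((_ , +-closed , _) , 1∉K , _) =
    ⊥-elim (1∉K (subst (_∈ K) (x+[-x+y]≡y a 1#) (+-closed _ _ a∈K (-a+1∈J K K-max))))
    where
    a∈K : a ∈ K
    a∈K = Ra⊆K (subst (_∈ principal a) (*-identityˡ a) (∈-principal⁺ 1# a))

module RingHomProperties {R S : FiniteRing} {π : Elt R → Elt S} (hom : IsRingHom R S π) where

  private
    module R = FiniteRingProperties R
    module S = FiniteRingProperties S
  open IsRingHom hom public
  open ≡-Reasoning

  0#-homo : π R.0# ≡ S.0#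
  0#-homo = S.+-cancelˡ (π R.0#) (π R.0#) S.0# (begin
    π R.0# S.+ π R.0#  ≡⟨ sym (+-hom R.0# R.0#) ⟩
    π (R.0# R.+ R.0#)  ≡⟨ cong π (R.+-identityʳ R.0#) ⟩
    π R.0#             ≡⟨ sym (S.+-identityʳ (π R.0#)) ⟩
    π R.0# S.+ S.0#    ∎)

  -‿homo : ∀ x → π (R.- x) ≡ S.- π x
  -‿homo x = S.inverseʳ-unique (π x) (π (R.- x))
    (trans (sym (+-hom x (R.- x))) (trans (cong π (R.-‿inverseʳ x)) 0#-homo))

  *≡1-homo : ∀ {x y} → x R.* y ≡ R.1# → π x S.* π y ≡ S.1#
  *≡1-homo {x} {y} xy≡1 = trans (sym (*-hom x y)) (trans (cong π xy≡1) 1-hom)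

  IsUnit-homo : ∀ {u} → IsUnit R u → IsUnit S (π u)
  IsUnit-homo (v , uv≡1 , vu≡1) = π v , *≡1-homo uv≡1 , *≡1-homo vu≡1

module QuotientByJacobson
  {R S : FiniteRing} {π : Elt R → Elt S} (Q : IsQuotientByJacobson R S π) where

  private
    module R = FiniteRingProperties R
    module S = FiniteRingProperties S
  open IsQuotientByJacobson Q
  open RingHomProperties hom
  open LeftIdealProperties R using (-a+1∈J⇒leftInvertible)
  open UnitGraphProperties S using (nonAdjacent⇒∈)
  open Equivalence using (to; from)

  π≡π⇒-x+y∈J : ∀ {x y} → π x ≡ π y → InJacobson R (R.- x R.+ y)
  π≡π⇒-x+y∈J {x} {y} πx≡πy = to (kernel _) (begin
    π (R.- x R.+ y)    ≡⟨ +-hom (R.- x) y ⟩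
    π (R.- x) S.+ π y  ≡⟨ cong₂ S._+_ (-‿homo x) (sym πx≡πy) ⟩
    S.- π x S.+ π x    ≡⟨ S.-‿inverseˡ (π x) ⟩
    S.0#               ∎)
    where open ≡-Reasoning

  j∈J⇒π[x+j]≡πx : ∀ {x j} → InJacobson R j → π (x R.+ j) ≡ π x
  j∈J⇒π[x+j]≡πx {x} {j} j∈J =
    trans (+-hom x j) (trans (cong (π x S.+_) (from (kernel j) j∈J)) (S.+-identityʳ (π x)))

  leftInvertible-lift : ∀ {u} → IsUnit S (π u) → ∃ λ l → l R.* u ≡ R.1#
  leftInvertible-lift {u} (v̄ , _ , v̄πu≡1) with surjective v̄
  ... | v , refl with -a+1∈J⇒leftInvertible (v R.* u)
                        (π≡π⇒-x+y∈J (trans (*-hom v u) (trans v̄πu≡1 (sym 1-hom))))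
  ... | w , w[vu]≡1 = w R.* v , trans (R.*-assoc w v u) w[vu]≡1

  IsUnit-lift : ∀ {u} → IsUnit S (π u) → IsUnit R u
  IsUnit-lift πu-unit with leftInvertible-lift πu-unit
  ... | l , lu≡1 with leftInvertible-lift (S.leftInverse-of-unit-isUnit (*≡1-homo lu≡1) πu-unit)
  ... | l′ , l′l≡1 =
    l , subst (λ t → t R.* l ≡ R.1#) (R.leftInverse≡rightInverse l′l≡1 lu≡1) l′l≡1 , lu≡1

  IsUnit-resp-π : ∀ {x y} → IsUnit R y → π x ≡ π y → IsUnit R x
  IsUnit-resp-π y-unit πx≡πy = IsUnit-lift (subst (IsUnit S) (sym πx≡πy) (IsUnit-homo y-unit))

  Adjacent-lift : ∀ {a c} → Adjacent S (π a) (π c) → Adjacent R a c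
  Adjacent-lift {a} {c} (πa≢πc , πa+πc-unit) =
    πa≢πc ∘ cong π , IsUnit-lift (subst (IsUnit S) (sym (+-hom a c)) πa+πc-unit)

  Adjacent-push : ∀ {a c} → Adjacent R a c → π a ≢ π c → Adjacent S (π a) (π c)
  Adjacent-push {a} {c} (_ , a+c-unit) πa≢πc =
    πa≢πc , subst (IsUnit S) (+-hom a c) (IsUnit-homo a+c-unit)

  IsUnit[x+y]⇒IsUnit[πx] : ∀ {x y} → IsUnit R (x R.+ y) → π x ≡ π y → IsUnit S (π x)
  IsUnit[x+y]⇒IsUnit[πx] {x} {y} x+y-unit πx≡πy = S.IsUnit[x+x]⇒IsUnit[x]
    (subst (λ t → IsUnit S (π x S.+ t)) (sym πx≡πy)
      (subst (IsUnit S) (+-hom x y) (IsUnit-homo x+y-unit)))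

  π≡π⇒Adjacent : IsUnit R (R.1# R.+ R.1#) →
    ∀ {x y} → IsUnit S (π y) → π x ≡ π y → x ≢ y → Adjacent R x y
  π≡π⇒Adjacent 2-unit {x} {y} πy-unit πx≡πy x≢y = x≢y , IsUnit-resp-π y+y-unit πx+y≡π[y+y]
    where
    y+y-unit : IsUnit R (y R.+ y)
    y+y-unit = subst (IsUnit R) (sym (R.x+x≡[1+1]*x y)) (R.IsUnit-* 2-unit (IsUnit-lift πy-unit))
    πx+y≡π[y+y] : π (x R.+ y) ≡ π (y R.+ y)
    πx+y≡π[y+y] = trans (+-hom x y) (trans (cong (S._+ π y) πx≡πy) (sym (+-hom y y)))

  ∣preimage⁅y⁆∣≡∣J∣ : ∀ {Js} → (∀ z → z ∈ Js ⇔ InJacobson R z) → ∀ y → ∣ preimage π ⁅ y ⁆ ∣ ≡ ∣ Js ∣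
  ∣preimage⁅y⁆∣≡∣J∣ {Js} Js≡J y with surjective y
  ... | a , refl = ≤-antisym
    (injectiveOn⇒∣p∣≤∣q∣ (R.- a R.+_)
      (λ x∈ → from (Js≡J _) (π≡π⇒-x+y∈J (sym (x∈⁅y⁆⇒x≡y _ (∈-preimage⁻ x∈)))))
      (λ _ _ → R.+-cancelˡ _ _ _))
    (injectiveOn⇒∣p∣≤∣q∣ (a R.+_)
      (λ j∈ → ∈-preimage⁺ (subst (_∈ ⁅ π a ⁆) (sym (j∈J⇒π[x+j]≡πx (to (Js≡J _) j∈))) (x∈⁅x⁆ (π a))))
      (λ _ _ → R.+-cancelˡ _ _ _))

  M+J≡preimage : ∀ {M̄ M MJ} →
    (∀ y → y ∈ M̄ ⇔ ∃ λ x → x ∈ M × π x ≡ y) →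
    (∀ z → z ∈ MJ ⇔ ∃ λ m → ∃ λ j → m ∈ M × InJacobson R j × z ≡ m R.+ j) →
    MJ ≡ preimage π M̄
  M+J≡preimage {M̄} {M} {MJ} M̄≡π[M] MJ≡M+J = ⊆-antisym
    (λ {z} z∈MJ → M+J⊆preimage (to (MJ≡M+J z) z∈MJ))
    (λ {z} z∈ → preimage⊆M+J (to (M̄≡π[M] (π z)) (∈-preimage⁻ z∈)))
    where
    M+J⊆preimage : ∀ {z} →
      (∃ λ m → ∃ λ j → m ∈ M × InJacobson R j × z ≡ m R.+ j) → z ∈ preimage π M̄
    M+J⊆preimage (m , j , m∈M , j∈J , refl) =
      ∈-preimage⁺ (from (M̄≡π[M] _) (m , m∈M , sym (j∈J⇒π[x+j]≡πx j∈J)))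
    preimage⊆M+J : ∀ {z} → (∃ λ m → m ∈ M × π m ≡ π z) → z ∈ MJ
    preimage⊆M+J {z} (m , m∈M , πm≡πz) =
      from (MJ≡M+J z) (m , R.- m R.+ z , m∈M , π≡π⇒-x+y∈J πm≡πz , sym (R.x+[-x+y]≡y m z))

  module _ {M̄ : Subset S.size} (M̄-max : MaximalIndependentSet S M̄) where

    Adjacent⇒π≡π : ∀ {A x y} → (∀ z → z ∈ A → π z ∈ M̄) → x ∈ A → y ∈ A → Adjacent R x y → π x ≡ π y
    Adjacent⇒π≡π {x = x} {y} π[A]⊆M̄ x∈A y∈A adj = decidable-stable (π x ≟ π y) λ πx≢πy →
      proj₁ M̄-max (π x) (π y) (π[A]⊆M̄ x x∈A) (π[A]⊆M̄ y y∈A) (Adjacent-push adj πx≢πy)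

    π[B]⊆M̄ : ∀ {B} → IndependentSet R B → (∀ y → y ∈ M̄ → ∃ λ m → m ∈ B × π m ≡ y) →
      ∀ {b} → b ∈ B → π b ∈ M̄
    π[B]⊆M̄ {B} B-ind M̄⊆π[B] {b} b∈B = nonAdjacent⇒∈ M̄-max nonAdjacent
      where
      nonAdjacent : ∀ y → y ∈ M̄ → ¬ Adjacent S y (π b)
      nonAdjacent y y∈M̄ with M̄⊆π[B] y y∈M̄
      ... | m , m∈B , refl = B-ind m b m∈B b∈B ∘ Adjacent-lift

    preimage-maximalIndependent : (∀ y → y ∈ M̄ → ¬ IsUnit S y) →
      MaximalIndependentSet R (preimage π M̄)
    preimage-maximalIndependent nonunits = independent , maximal
      where
      independent : IndependentSet R (preimage π M̄)
      independent x y x∈ y∈ adj = nonunits (π x) (∈-preimage⁻ x∈)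
        (IsUnit[x+y]⇒IsUnit[πx] (proj₂ adj) (Adjacent⇒π≡π (λ _ → ∈-preimage⁻) x∈ y∈ adj))

      maximal : ∀ B → IndependentSet R B → preimage π M̄ ⊆ B → B ⊆ preimage π M̄
      maximal B B-ind preimage⊆B b∈B = ∈-preimage⁺ (π[B]⊆M̄ B-ind M̄⊆π[B] b∈B)
        where
        M̄⊆π[B] : ∀ y → y ∈ M̄ → ∃ λ m → m ∈ B × π m ≡ y
        M̄⊆π[B] y y∈M̄ with surjective y
        ... | m , refl = m , preimage⊆B (∈-preimage⁺ y∈M̄) , refl

    representatives-maximalIndependent : (∀ y → y ∈ M̄ → IsUnit S y) → IsUnit R (R.1# R.+ R.1#) →
      ∀ {M} → (∀ x → x ∈ M → π x ∈ M̄) → (∀ x y → x ∈ M → y ∈ M → π x ≡ π y → x ≡ y) →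
      (∀ y → y ∈ M̄ → ∃ λ x → x ∈ M × π x ≡ y) → MaximalIndependentSet R M
    representatives-maximalIndependent units 2-unit {M} π[M]⊆M̄ π-injective M̄⊆π[M] =
      independent , maximal
      where
      independent : IndependentSet R M
      independent x y x∈M y∈M adj =
        proj₁ adj (π-injective x y x∈M y∈M (Adjacent⇒π≡π π[M]⊆M̄ x∈M y∈M adj))

      maximal : ∀ B → IndependentSet R B → M ⊆ B → B ⊆ M
      maximal B B-ind M⊆B {b} b∈B = representative∈M (M̄⊆π[M] (π b) (π[B]⊆M̄ B-ind M̄⊆π[B] b∈B))
        where
        M̄⊆π[B] : ∀ y → y ∈ M̄ → ∃ λ m → m ∈ B × π m ≡ y
        M̄⊆π[B] y y∈M̄ = map₂ (map₁ M⊆B) (M̄⊆π[M] y y∈M̄)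

        representative∈M : (∃ λ m → m ∈ M × π m ≡ π b) → b ∈ M
        representative∈M (m , m∈M , πm≡πb) = subst (_∈ M) (sym b≡m) m∈M
          where
          b≡m : b ≡ m
          b≡m = decidable-stable (b ≟ m) λ b≢m → B-ind b m b∈B (M⊆B m∈M)
            (π≡π⇒Adjacent 2-unit (units (π m) (π[M]⊆M̄ m m∈M)) (sym πm≡πb) b≢m)

open import Data.Nat using (_*_)

lemma2p6 : (R S : FiniteRing) (π : Fin (FiniteRing.size R) → Fin (FiniteRing.size S))
    → IsQuotientByJacobson R S π
    → (M̄ : Subset (FiniteRing.size S))
    → MaximalIndependentSet S M̄
    → ((∀ y → y ∈ M̄ → ¬ IsUnit S y)
        → (M : Subset (FiniteRing.size R))
        → (∀ y → (y ∈ M̄) ⇔ (∃ λ x → (x ∈ M) × (π x ≡ y)))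
        → (MJ : Subset (FiniteRing.size R))
        → (∀ z → (z ∈ MJ) ⇔ (∃ λ m → ∃ λ j → (m ∈ M) × InJacobson R j × (z ≡ FiniteRing._+_ R m j)))
        → (Js : Subset (FiniteRing.size R))
        → (∀ z → (z ∈ Js) ⇔ InJacobson R z)
        → MaximalIndependentSet R MJ × (∣ MJ ∣ ≡ ∣ M̄ ∣ * ∣ Js ∣))
      × ((∀ y → y ∈ M̄ → IsUnit S y)
        → IsUnit R (FiniteRing._+_ R (FiniteRing.1# R) (FiniteRing.1# R))
        → (M : Subset (FiniteRing.size R))
        → (∀ x → x ∈ M → π x ∈ M̄)
        → (∀ x y → x ∈ M → y ∈ M → π x ≡ π y → x ≡ y)
        → (∀ y → y ∈ M̄ → ∃ λ x → (x ∈ M) × (π x ≡ y))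
        → MaximalIndependentSet R M × (∣ M ∣ ≡ ∣ M̄ ∣))
lemma2p6 R S π Q M̄ M̄-max =
  (λ nonunits M M̄≡π[M] MJ MJ≡M+J Js Js≡J →
    subst (λ A → MaximalIndependentSet R A × ∣ A ∣ ≡ ∣ M̄ ∣ * ∣ Js ∣)
      (sym (M+J≡preimage M̄≡π[M] MJ≡M+J))
      ( preimage-maximalIndependent M̄-max nonunits
      , ∣preimage∣≡∣c∣*k π ∣ Js ∣ (∣preimage⁅y⁆∣≡∣J∣ Js≡J) M̄
      )) ,
  (λ units 2-unit M π[M]⊆M̄ π-injective M̄⊆π[M] →
    ( representatives-maximalIndependent M̄-max units 2-unit π[M]⊆M̄ π-injective M̄⊆π[M]
    , ≤-antisym (injectiveOn⇒∣p∣≤∣q∣ π (π[M]⊆M̄ _) (π-injective _ _))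
                (surjectiveOn⇒∣q∣≤∣p∣ π (M̄⊆π[M] _))
    ))
  where open QuotientByJacobson Q
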